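{- Let $G\le S_m$ act on $\Delta=\{1,\dots,m\}$, let $r\ge1$, and let $\pi=(\sigma,\tau)\in G\wr S_r$, acting on $\Delta^r$. Suppose $(a_1,\dots,a_r),(b_1,\dots,b_r)\in\Delta^r$ lie in $\pi$-cycles whose sizes are divisible by distinct primes $q$ and $s$ respectively. Then at least one of the following holds: (1) $\pi$ has a cycle on $\Delta^r$ of size divisible by $qs$; (2) there exist $i\in\{1,\dots,r\}$ and an integer $t$ coprime to $qs$ such that $\tau^t(i)=i$ and, for every $j\ne i$, the $j$-th component of $\pi^t(a_1,\dots,a_r)$ is $a_j$ and the $j$-th component of $\pi^t(b_1,\dots,b_r)$ is $b_j$.
   Context: The wreath product $G\wr S_r=G^r\rtimes S_r$, with $S_r$ permuting coordinates; its elements are pairs $(\sigma,\tau)$ with $\sigma=(\sigma_1,\dots,\sigma_r)\in G^r$, $\tau\in S_r$. It acts on $\Delta^r$ by $(\sigma,\tau)(x_1,\dots,x_r)=(\sigma_1(x_{\tau^{ -1}(1)}),\dots,\sigma_r(x_{\tau^{ -1}(r)}))$, giving an embedding into $S_{m^r}$; cycles of $\pi$ refer to this permutation of $\Delta^r$. -}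

module Defs where

open import Data.Nat using (ℕ; zero; suc; _<_; _*_)
open import Data.Nat.Divisibility using (_∣_)
open import Data.Nat.Primality using (Prime)
open import Data.Nat.Coprimality using (Coprime)
open import Data.Integer using (ℤ; +_; -[1+_]; ∣_∣)
open import Data.Fin using (Fin)
open import Data.Fin.Permutation using (Permutation′; _⟨$⟩ʳ_; _⟨$⟩ˡ_; id; flip; _∘ₚ_)
open import Data.Vec using (Vec; tabulate; lookup)
open import Data.Product using (_×_; Σ; ∃)
open import Relation.Binary.PropositionalEquality using (_≡_; _≢_)

record Subgroup (m : ℕ) : Set₁ where
  field
    Carrier   : Permutation′ m → Set
    respects  : ∀ {g h} → (∀ x → g ⟨$⟩ʳ x ≡ h ⟨$⟩ʳ x) → Carrier g → Carrier h
    has-id    : Carrier id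
    closed-∘  : ∀ {g h} → Carrier g → Carrier h → Carrier (g ∘ₚ h)
    closed-⁻¹ : ∀ {g} → Carrier g → Carrier (flip g)

record WreathElt {m : ℕ} (G : Subgroup m) (r : ℕ) : Set where
  field
    σ    : Fin r → Permutation′ m
    σ∈G  : ∀ i → Subgroup.Carrier G (σ i)
    τ    : Permutation′ r

Point : ℕ → ℕ → Set
Point m r = Vec (Fin m) r

module _ {m : ℕ} {G : Subgroup m} {r : ℕ} (π : WreathElt G r) where
  open WreathElt π

  act : Point m r → Point m r
  act x = tabulate λ j → σ j ⟨$⟩ʳ lookup x (τ ⟨$⟩ˡ j)

  actInv : Point m r → Point m r
  actInv y = tabulate λ k → σ (τ ⟨$⟩ʳ k) ⟨$⟩ˡ lookup y (τ ⟨$⟩ʳ k)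

  iterN : ℕ → Point m r → Point m r
  iterN zero    x = x
  iterN (suc n) x = act (iterN n x)

  iterInvN : ℕ → Point m r → Point m r
  iterInvN zero    x = x
  iterInvN (suc n) x = actInv (iterInvN n x)

  pow : ℤ → Point m r → Point m r
  pow (+ n)      x = iterN n x
  pow -[1+ n ]   x = iterInvN (suc n) x

  CycleSize : Point m r → ℕ → Set
  CycleSize x n = (0 < n) × (iterN n x ≡ x) × (∀ k → 0 < k → k < n → iterN k x ≢ x)

permPow : {r : ℕ} → Permutation′ r → ℤ → Fin r → Fin r
permPow τ (+ zero)      i = i
permPow τ (+ suc n)     i = τ ⟨$⟩ʳ permPow τ (+ n) i
permPow τ -[1+ zero ]   i = τ ⟨$⟩ˡ i
permPow τ -[1+ suc n ]  i = τ ⟨$⟩ˡ permPow τ -[1+ n ] i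

{-# OPTIONS --safe #-}
module Submission where

-- Write na = q^α u and nb = s^β v with q ∤ u and s ∤ v; if s ∣ na or q ∣ nb, a or b itself lies in the
-- required cycle. Otherwise ρ = π^(uv) moves both a and b, while ρ^(q^α) fixes a and ρ^(s^β) fixes b.
-- If a set S of coordinates is invariant under the coordinate permutation κ = τ^(-uv) of ρ, gluing a on S
-- to b off S gives a point whose period is divisible by q if a moves on S and by s if b moves off S.
-- Take for S the κ-orbit, of length c, of a coordinate where a moves. If gluing fails, a and b move only
-- on S. Then if q ∣ c or s ∣ c, a point built along the orbit has period divisible by c and by the other
-- prime; otherwise κ^c fixes S pointwise, and gluing for ρ^c and a single coordinate of S yields either
-- such a point or alternative (2) with t = uvc.

open import Defs
open import Data.Bool using (Bool; true; false; not; if_then_else_)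
open import Data.Bool.Properties using (not-injective) renaming (_≟_ to _≟ᵇ_)
open import Data.Fin using (Fin; toℕ; fromℕ<) renaming (_≟_ to _≟ᶠ_)
open import Data.Fin.Permutation using (Permutation′; _⟨$⟩ʳ_; _⟨$⟩ˡ_; flip; inverseˡ; inverseʳ)
open import Data.Fin.Properties using (any?; pigeonhole; toℕ<n; toℕ-fromℕ<)
open import Data.Integer using (+_; ∣_∣)
open import Data.Nat using (ℕ; zero; suc; _+_; _*_; _∸_; _^_; _≤_; _<_; _%_; _/_; _<?_; _≤?_; z≤n; s≤s;
  nonTrivial⇒n>1; >-nonZero)
open import Data.Nat.Coprimality using (Coprime; coprime-divisor)
open import Data.Nat.Divisibility using (_∣_; _∣?_; divides; ∣-trans; ∣1⇒≡1; *-monoʳ-∣; m%n≡0⇒n∣m; ∣⇒≤)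
open import Data.Nat.DivMod using (m%n<n; m%n≡m∸m/n*n)
open import Data.Nat.Induction using (<-rec)
open import Data.Nat.Primality using (Prime; euclidsLemma; prime⇒irreducible; prime⇒nonTrivial; prime⇒nonZero)
open import Data.Nat.Properties
open import Data.Product using (_×_; _,_; proj₁; proj₂; ∃; ∃₂; ∃-syntax)
open import Data.Sum using (_⊎_; inj₁; inj₂; [_,_]′; map₂)
open import Data.Vec using (lookup; tabulate; replicate; _[_]≔_)
open import Data.Vec.Properties using (lookup∘tabulate; lookup∘updateAt; lookup∘updateAt′; ≡-dec)
open import Data.Vec.Recursive using (Fin[m^n]↔Fin[m]^n)
open import Data.Vec.Recursive.Properties using (↔Vec)
open import Data.Vec.Relation.Binary.Pointwise.Extensional using (ext; Pointwise-≡⇒≡)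
open import Function.Base using (_∘_)
open import Function.Bundles using (_↣_; Injection; mk⇔)
open import Function.Construct.Identity using (↣-id)
open import Function.Definitions using (Injective)
open import Function.Properties.Inverse using (↔-sym; ↔-trans; ↔⇒↣)
open import Relation.Binary.Definitions using (tri<; tri≈; tri>)
open import Relation.Binary.PropositionalEquality
  using (_≡_; _≢_; refl; sym; trans; cong; subst; isEquivalence; module ≡-Reasoning)
open import Relation.Binary.Structures using (IsEquivalence)
open import Relation.Nullary using (¬_; Dec; yes; no; does; contradiction)
open import Relation.Nullary.Decidable using (_×-dec_; ¬?; decidable-stable; does-⇔; dec-true; dec-false)
open import Relation.Unary using (Decidable)

prime>1 : ∀ {p} → Prime p → 1 < p
prime>1 {p} pp = nonTrivial⇒n>1 p ⦃ prime⇒nonTrivial pp ⦄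

prime∤⇒coprime : ∀ {p n} → Prime p → ¬ p ∣ n → Coprime n p
prime∤⇒coprime pp p∤n (d∣n , d∣p) with prime⇒irreducible pp d∣p
... | inj₁ d≡1 = d≡1
... | inj₂ refl = contradiction d∣n p∤n

prime∤* : ∀ {p a b} → Prime p → ¬ p ∣ a → ¬ p ∣ b → ¬ p ∣ a * b
prime∤* {a = a} {b} pp p∤a p∤b p∣ab = [ p∤a , p∤b ]′ (euclidsLemma a b pp p∣ab)

distinct-primes⇒coprime : ∀ {p q} → Prime p → Prime q → p ≢ q → Coprime q p
distinct-primes⇒coprime pp pq p≢q = prime∤⇒coprime pp λ p∣q →
  [ (λ p≡1 → <-irrefl (sym p≡1) (prime>1 pp)) , p≢q ]′ (prime⇒irreducible pq p∣q)

coprime-* : ∀ {t a b} → Coprime t a → Coprime t b → Coprime t (a * b)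
coprime-* t⊥a t⊥b {d} (d∣t , d∣ab) =
  t⊥b (d∣t , coprime-divisor (λ (e∣d , e∣a) → t⊥a (∣-trans e∣d d∣t , e∣a)) d∣ab)

coprime-∣⇒*∣ : ∀ {a b n} → Coprime b a → a ∣ n → b ∣ n → a * b ∣ n
coprime-∣⇒*∣ {a} {b} b⊥a (divides k refl) b∣ka =
  subst (a * b ∣_) (*-comm a k) (*-monoʳ-∣ a (coprime-divisor b⊥a (subst (b ∣_) (*-comm k a) b∣ka)))

∣p^e⇒≡1⊎p∣ : ∀ {p d} e → Prime p → d ∣ p ^ e → d ≡ 1 ⊎ p ∣ d
∣p^e⇒≡1⊎p∣ zero pp d∣1 = inj₁ (∣1⇒≡1 d∣1)
∣p^e⇒≡1⊎p∣ {p} {d} (suc e) pp d∣p^1+e with p ∣? d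
... | yes p∣d = inj₂ p∣d
... | no p∤d = ∣p^e⇒≡1⊎p∣ e pp (coprime-divisor (prime∤⇒coprime pp p∤d) d∣p^1+e)

split-prime-part : ∀ {p} → Prime p → ∀ n → 0 < n → ∃₂ λ e u → n ≡ p ^ e * u × ¬ p ∣ u
split-prime-part {p} pp = <-rec _ split
  where
  split : ∀ n → (∀ {k} → k < n → 0 < k → ∃₂ λ e u → k ≡ p ^ e * u × ¬ p ∣ u) →
          0 < n → ∃₂ λ e u → n ≡ p ^ e * u × ¬ p ∣ u
  split n rec 0<n with p ∣? n
  ... | no p∤n = 0 , n , sym (+-identityʳ n) , p∤n
  ... | yes (divides (suc k) refl) with rec (m<m*n (suc k) p (prime>1 pp)) (s≤s z≤n)
  ...   | e , u , k≡p^eu , p∤u = suc e , u , p^1+e-factor , p∤u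
    where
    p^1+e-factor : suc k * p ≡ p ^ suc e * u
    p^1+e-factor = begin
      suc k * p       ≡⟨ cong (_* p) k≡p^eu ⟩
      p ^ e * u * p   ≡⟨ *-comm (p ^ e * u) p ⟩
      p * (p ^ e * u) ≡⟨ *-assoc p (p ^ e) u ⟨
      p ^ suc e * u   ∎
      where open ≡-Reasoning

IsLeastPositive : (ℕ → Set) → ℕ → Set
IsLeastPositive Z n = (0 < n) × Z n × (∀ k → 0 < k → k < n → ¬ Z k)

leastPositive : ∀ {Z : ℕ → Set} → Decidable Z → ∀ {n} → 0 < n → Z n → ∃ (IsLeastPositive Z)
leastPositive {Z} Z? {n} 0<n zn with lowest n
  where
  lowest : ∀ n → (∀ k → 0 < k → k ≤ n → ¬ Z k) ⊎ ∃ (IsLeastPositive Z)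
  lowest zero = inj₁ λ { k 0<k k≤0 → contradiction (<-≤-trans 0<k k≤0) (<-irrefl refl) }
  lowest (suc n) with lowest n
  ... | inj₂ least = inj₂ least
  ... | inj₁ none with Z? (suc n)
  ...   | yes z = inj₂ (suc n , s≤s z≤n , z , λ k 0<k k<1+n → none k 0<k (≤-pred k<1+n))
  ...   | no ¬z = inj₁ λ k 0<k k≤1+n → [ (λ k<1+n → none k 0<k (≤-pred k<1+n)) , (λ { refl → ¬z }) ]′ (m≤n⇒m<n∨m≡n k≤1+n)
... | inj₁ none = contradiction zn (none n 0<n ≤-refl)
... | inj₂ least = least

record IsSubtractiveSubmonoid (Z : ℕ → Set) : Set where
  field
    0∈ : Z 0
    +-closed : ∀ {a b} → Z a → Z b → Z (a + b)
    ∸-closed : ∀ {a b} → Z a → Z b → Z (a ∸ b)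

  *-closed : ∀ {n} → Z n → ∀ k → Z (k * n)
  *-closed zn zero = 0∈
  *-closed zn (suc k) = +-closed zn (*-closed zn k)

  leastPositive∣ : ∀ {d n} → IsLeastPositive Z d → Z n → d ∣ n
  leastPositive∣ {suc d} {n} (_ , zd , below) zn with n % suc d in n%d≡r
  ... | zero = m%n≡0⇒n∣m n (suc d) n%d≡r
  ... | suc r = contradiction zr (below (suc r) (s≤s z≤n) (subst (_< suc d) n%d≡r (m%n<n n (suc d))))
    where
    zr : Z (suc r)
    zr = subst Z (trans (sym (m%n≡m∸m/n*n n (suc d))) n%d≡r) (∸-closed zn (*-closed zd (n / suc d)))

  prime∣members : Decidable Z → ∀ {p e n} → Prime p → Z (p ^ e) → ¬ Z 1 → Z n → p ∣ n
  prime∣members Z? {p} {e} pp zpe ∌1 zn with leastPositive Z? (m^n>0 p e) zpe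
    where instance _ = prime⇒nonZero pp
  ... | d , least with ∣p^e⇒≡1⊎p∣ e pp (leastPositive∣ least zpe)
  ...   | inj₁ refl = contradiction (proj₁ (proj₂ least)) ∌1
  ...   | inj₂ p∣d = ∣-trans p∣d (leastPositive∣ least zn)

module _ {A : Set} {_≈_ : A → A → Set} (≈-equiv : IsEquivalence _≈_) (T : ℕ → A → A)
         (T-zero : ∀ x → T 0 x ≡ x) (T-+ : ∀ a b x → T (a + b) x ≡ T a (T b x))
         (T-cong : ∀ k {x y} → x ≈ y → T k x ≈ T k y) where
  open IsEquivalence ≈-equiv using (reflexive) renaming (sym to ≈-sym; trans to ≈-trans)

  stabiliser-isSubtractive : ∀ x → IsSubtractiveSubmonoid (λ k → T k x ≈ x)
  stabiliser-isSubtractive x = record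
    { 0∈ = reflexive (T-zero x)
    ; +-closed = λ {a} {b} a∈ b∈ → ≈-trans (reflexive (T-+ a b x)) (≈-trans (T-cong a b∈) a∈)
    ; ∸-closed = ∸-closed
    }
    where
    ∸-closed : ∀ {a b} → T a x ≈ x → T b x ≈ x → T (a ∸ b) x ≈ x
    ∸-closed {a} {b} a∈ b∈ with b ≤? a
    ... | no b≰a = subst (λ k → T k x ≈ x) (sym (m≤n⇒m∸n≡0 (<⇒≤ (≰⇒> b≰a)))) (reflexive (T-zero x))
    ... | yes b≤a = ≈-trans (≈-sym (T-cong (a ∸ b) b∈)) (≈-trans (reflexive T[a∸b+b]) a∈)
      where
      T[a∸b+b] : T (a ∸ b) (T b x) ≡ T a x
      T[a∸b+b] = trans (sym (T-+ (a ∸ b) b x)) (cong (λ k → T k x) (m∸n+n≡m b≤a))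

module _ {A : Set} {N : ℕ} (A↣Fin : A ↣ Fin N) (T : ℕ → A → A)
         (T-+ : ∀ a b x → T (a + b) x ≡ T a (T b x)) (T-injective : ∀ k → Injective _≡_ _≡_ (T k)) where
  open Injection A↣Fin using (to; injective)

  recurrent : ∀ x → ∃ λ k → 0 < k × T k x ≡ x
  recurrent x with pigeonhole (n<1+n N) (λ i → to (T (toℕ i) x))
  ... | i , j , i<j , same-code = toℕ j ∸ toℕ i , m<n⇒0<n∸m i<j , T-injective (toℕ i) T[i+d]≡T[i]
    where
    T[i+d]≡T[i] : T (toℕ i) (T (toℕ j ∸ toℕ i) x) ≡ T (toℕ i) x
    T[i+d]≡T[i] = begin
      T (toℕ i) (T (toℕ j ∸ toℕ i) x) ≡⟨ T-+ (toℕ i) (toℕ j ∸ toℕ i) x ⟨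
      T (toℕ i + (toℕ j ∸ toℕ i)) x   ≡⟨ cong (λ k → T k x) (m+[n∸m]≡n (<⇒≤ i<j)) ⟩
      T (toℕ j) x                     ≡⟨ injective same-code ⟨
      T (toℕ i) x                     ∎
      where open ≡-Reasoning

scale-+ : ∀ {A : Set} (T : ℕ → A → A) → (∀ a b x → T (a + b) x ≡ T a (T b x)) →
          ∀ t a b x → T (t * (a + b)) x ≡ T (t * a) (T (t * b) x)
scale-+ T T-+ t a b x = trans (cong (λ k → T k x) (*-distribˡ-+ t a b)) (T-+ (t * a) (t * b) x)

Point↣Fin : ∀ m r → Point m r ↣ Fin (m ^ r)
Point↣Fin m r = ↔⇒↣ (↔-sym (↔-trans (Fin[m^n]↔Fin[m]^n m r) (↔Vec r)))

⟨$⟩ʳ-injective : ∀ {n} (ρ : Permutation′ n) → Injective _≡_ _≡_ (ρ ⟨$⟩ʳ_)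
⟨$⟩ʳ-injective ρ = Injection.injective (↔⇒↣ ρ)

does⇒ : ∀ {A : Set} (a? : Dec A) → does a? ≡ true → A
does⇒ (yes a) _ = a

other-than : ∀ {m} {v w : Fin m} → v ≢ w → ∀ u → ∃ λ x → x ≢ u
other-than {v = v} {w} v≢w u with v ≟ᶠ u
... | yes refl = w , λ w≡v → v≢w (sym w≡v)
... | no v≢u = v , v≢u

CoordSet : ℕ → Set
CoordSet r = Fin r → Bool

∁ : ∀ {r} → CoordSet r → CoordSet r
∁ S j = not (S j)

record _≈[_]_ {m r} (x : Point m r) (S : CoordSet r) (y : Point m r) : Set where
  constructor agreeOn
  field agree : ∀ j → S j ≡ true → lookup x j ≡ lookup y j
open _≈[_]_ public

⁅_⁆ : ∀ {r} → Fin r → CoordSet r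
⁅ i ⁆ j = does (j ≟ᶠ i)

i∈⁅i⁆ : ∀ {r} (i : Fin r) → ⁅ i ⁆ i ≡ true
i∈⁅i⁆ i = dec-true (i ≟ᶠ i) refl

∈⁅⁆⇒≡ : ∀ {r} {i j : Fin r} → ⁅ i ⁆ j ≡ true → j ≡ i
∈⁅⁆⇒≡ {i = i} {j} = does⇒ (j ≟ᶠ i)

≢⇒∈∁⁅⁆ : ∀ {r} {i j : Fin r} → j ≢ i → ∁ ⁅ i ⁆ j ≡ true
≢⇒∈∁⁅⁆ {i = i} {j} j≢i = cong not (dec-false (j ≟ᶠ i) j≢i)

module _ {m r : ℕ} (S : CoordSet r) where

  ≈[]-isEquivalence : IsEquivalence (λ (x y : Point m r) → x ≈[ S ] y)
  ≈[]-isEquivalence = record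
    { refl = agreeOn λ _ _ → refl
    ; sym = λ x≈y → agreeOn λ j j∈S → sym (agree x≈y j j∈S)
    ; trans = λ x≈y y≈z → agreeOn λ j j∈S → trans (agree x≈y j j∈S) (agree y≈z j j∈S)
    }

  agree-or-differ : ∀ (x y : Point m r) → x ≈[ S ] y ⊎ ∃ λ j → S j ≡ true × lookup x j ≢ lookup y j
  agree-or-differ x y with any? (λ j → (S j ≟ᵇ true) ×-dec ¬? (lookup x j ≟ᶠ lookup y j))
  ... | yes differ = inj₂ differ
  ... | no ¬differ = inj₁ (agreeOn λ j j∈S → decidable-stable (lookup x j ≟ᶠ lookup y j) (λ x≢y → ¬differ (j , j∈S , x≢y)))

  ≈[]-dec : ∀ (x y : Point m r) → Dec (x ≈[ S ] y)
  ≈[]-dec x y with agree-or-differ x y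
  ... | inj₁ x≈y = yes x≈y
  ... | inj₂ (j , j∈S , x≢y) = no λ x≈y → x≢y (agree x≈y j j∈S)

  glue : Point m r → Point m r → Point m r
  glue x y = tabulate λ j → if S j then lookup x j else lookup y j

  glue-≈ˡ : ∀ x y → glue x y ≈[ S ] x
  glue-≈ˡ x y = agreeOn λ j j∈S → trans (lookup∘tabulate _ j) (cong (λ b → if b then lookup x j else lookup y j) j∈S)

  glue-≈ʳ : ∀ x y → glue x y ≈[ ∁ S ] y
  glue-≈ʳ x y = agreeOn λ j j∉S →
    trans (lookup∘tabulate _ j) (cong (λ b → if b then lookup x j else lookup y j) (not-injective j∉S))

module _ {m : ℕ} {G : Subgroup m} {r : ℕ} (π : WreathElt G r) where
  open WreathElt π

  π^ : ℕ → Point m r → Point m r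
  π^ = iterN π

  τ⁻^ : ℕ → Fin r → Fin r
  τ⁻^ zero j = j
  τ⁻^ (suc k) j = τ⁻^ k (τ ⟨$⟩ˡ j)

  σ^ : ℕ → Fin r → Fin m → Fin m
  σ^ zero j y = y
  σ^ (suc k) j y = σ j ⟨$⟩ʳ σ^ k (τ ⟨$⟩ˡ j) y

  lookup-π^ : ∀ k x j → lookup (π^ k x) j ≡ σ^ k j (lookup x (τ⁻^ k j))
  lookup-π^ zero x j = refl
  lookup-π^ (suc k) x j = trans (lookup∘tabulate _ j) (cong (σ j ⟨$⟩ʳ_) (lookup-π^ k x (τ ⟨$⟩ˡ j)))

  π^-+ : ∀ a b x → π^ (a + b) x ≡ π^ a (π^ b x)
  π^-+ zero b x = refl
  π^-+ (suc a) b x = cong (act π) (π^-+ a b x)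

  π^-comm : ∀ a b x → π^ a (π^ b x) ≡ π^ b (π^ a x)
  π^-comm a b x = trans (sym (π^-+ a b x)) (trans (cong (λ k → π^ k x) (+-comm a b)) (π^-+ b a x))

  τ⁻^-+ : ∀ a b j → τ⁻^ (a + b) j ≡ τ⁻^ a (τ⁻^ b j)
  τ⁻^-+ a b j = trans (cong (λ k → τ⁻^ k j) (+-comm a b)) (τ⁻^-+ʳ b a j)
    where
    τ⁻^-+ʳ : ∀ a b j → τ⁻^ (a + b) j ≡ τ⁻^ b (τ⁻^ a j)
    τ⁻^-+ʳ zero b j = refl
    τ⁻^-+ʳ (suc a) b j = τ⁻^-+ʳ a b (τ ⟨$⟩ˡ j)

  τ⁻^-injective : ∀ k → Injective _≡_ _≡_ (τ⁻^ k)
  τ⁻^-injective zero eq = eq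
  τ⁻^-injective (suc k) eq = ⟨$⟩ʳ-injective (flip τ) (τ⁻^-injective k eq)

  τ⁻^-comm : ∀ a b j → τ⁻^ a (τ⁻^ b j) ≡ τ⁻^ b (τ⁻^ a j)
  τ⁻^-comm a b j = trans (sym (τ⁻^-+ a b j)) (trans (cong (λ k → τ⁻^ k j) (+-comm a b)) (τ⁻^-+ b a j))

  σ^-injective : ∀ k j → Injective _≡_ _≡_ (σ^ k j)
  σ^-injective zero j eq = eq
  σ^-injective (suc k) j eq = σ^-injective k (τ ⟨$⟩ˡ j) (⟨$⟩ʳ-injective (σ j) eq)

  act-injective : Injective _≡_ _≡_ (act π)
  act-injective {x} {y} eq = Pointwise-≡⇒≡ (ext λ i →
    subst (λ i′ → lookup x i′ ≡ lookup y i′) (inverseˡ τ) (σ^-injective 1 (τ ⟨$⟩ʳ i) (begin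
      σ^ 1 (τ ⟨$⟩ʳ i) (lookup x (τ⁻^ 1 (τ ⟨$⟩ʳ i))) ≡⟨ lookup-π^ 1 x (τ ⟨$⟩ʳ i) ⟨
      lookup (act π x) (τ ⟨$⟩ʳ i)                  ≡⟨ cong (λ z → lookup z (τ ⟨$⟩ʳ i)) eq ⟩
      lookup (act π y) (τ ⟨$⟩ʳ i)                  ≡⟨ lookup-π^ 1 y (τ ⟨$⟩ʳ i) ⟩
      σ^ 1 (τ ⟨$⟩ʳ i) (lookup y (τ⁻^ 1 (τ ⟨$⟩ʳ i))) ∎)))
    where open ≡-Reasoning

  π^-injective : ∀ k → Injective _≡_ _≡_ (π^ k)
  π^-injective zero eq = eq
  π^-injective (suc k) eq = π^-injective k (act-injective eq)

  cycleSize : ∀ x → ∃ (CycleSize π x)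
  cycleSize x with recurrent (Point↣Fin m r) π^ π^-+ π^-injective x
  ... | k , 0<k , π^kx≡x = leastPositive (λ n → ≡-dec _≟ᶠ_ (π^ n x) x) 0<k π^kx≡x

  periods-isSubtractive : ∀ x → IsSubtractiveSubmonoid (λ k → π^ k x ≡ x)
  periods-isSubtractive = stabiliser-isSubtractive isEquivalence π^ (λ _ → refl) π^-+ (λ k → cong (π^ k))

  Invariant : ℕ → CoordSet r → Set
  Invariant k S = ∀ j → S (τ⁻^ k j) ≡ S j

  Invariant-+ : ∀ {a b S} → Invariant a S → Invariant b S → Invariant (a + b) S
  Invariant-+ {a} {b} {S} inv-a inv-b j = trans (cong S (τ⁻^-+ a b j)) (trans (inv-a (τ⁻^ b j)) (inv-b j))

  Invariant-* : ∀ {t S} → Invariant t S → ∀ k → Invariant (t * k) S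
  Invariant-* {t} {S} inv zero j = cong (λ i → S (τ⁻^ i j)) (*-zeroʳ t)
  Invariant-* {t} {S} inv (suc k) j = trans (cong (λ i → S (τ⁻^ i j)) (*-suc t k)) (Invariant-+ {t} {t * k} inv (Invariant-* {t} inv k) j)

  ⁅⁆-Invariant : ∀ k {i} → τ⁻^ k i ≡ i → Invariant k ⁅ i ⁆
  ⁅⁆-Invariant k {i} τ⁻^ki≡i j = does-⇔ (mk⇔ (λ τ⁻^kj≡i → τ⁻^-injective k (trans τ⁻^kj≡i (sym τ⁻^ki≡i)))
                                             (λ { refl → τ⁻^ki≡i }))
                                        (τ⁻^ k j ≟ᶠ i) (j ≟ᶠ i)

  Invariant-∁ : ∀ {k S} → Invariant k S → Invariant k (∁ S)
  Invariant-∁ inv j = cong not (inv j)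

  lookup-π^-cong : ∀ k {x y j} → lookup x (τ⁻^ k j) ≡ lookup y (τ⁻^ k j) → lookup (π^ k x) j ≡ lookup (π^ k y) j
  lookup-π^-cong k {x} {y} {j} eq = begin
    lookup (π^ k x) j             ≡⟨ lookup-π^ k x j ⟩
    σ^ k j (lookup x (τ⁻^ k j))   ≡⟨ cong (σ^ k j) eq ⟩
    σ^ k j (lookup y (τ⁻^ k j))   ≡⟨ lookup-π^ k y j ⟨
    lookup (π^ k y) j             ∎
    where open ≡-Reasoning

  π^-preserves-≈[] : ∀ k {S x y} → Invariant k S → x ≈[ S ] y → π^ k x ≈[ S ] π^ k y
  π^-preserves-≈[] k inv x≈y = agreeOn λ j j∈S → lookup-π^-cong k (agree x≈y _ (trans (inv j) j∈S))

  period∣ : ∀ {x n k} → CycleSize π x n → π^ k x ≡ x → n ∣ k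
  period∣ {x} = IsSubtractiveSubmonoid.leastPositive∣ (periods-isSubtractive x)

  π^-*-fixed : ∀ {x n} → π^ n x ≡ x → ∀ k → π^ (k * n) x ≡ x
  π^-*-fixed {x} = IsSubtractiveSubmonoid.*-closed (periods-isSubtractive x)

  π^-*-fixed-under : ∀ t Q {y} → π^ (t * Q) y ≡ y → ∀ c → π^ (t * c * Q) y ≡ y
  π^-*-fixed-under t Q {y} fixed c =
    trans (cong (λ k → π^ k y) (trans (cong (_* Q) (*-comm t c)) (*-assoc c t Q))) (π^-*-fixed fixed c)

  Moves : ℕ → Point m r → Fin r → Set
  Moves t x j = lookup (π^ t x) j ≢ lookup x j

  moves-somewhere : ∀ {p n t y} → CycleSize π y n → p ∣ n → ¬ p ∣ t → ∃ (Moves t y)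
  moves-somewhere {p} {n} {t} {y} cs p∣n p∤t with agree-or-differ (λ _ → true) (π^ t y) y
  ... | inj₂ (j , _ , moves) = j , moves
  ... | inj₁ π^ty≈y = contradiction (∣-trans p∣n (period∣ cs π^ty≡y)) p∤t
    where
    π^ty≡y : π^ t y ≡ y
    π^ty≡y = Pointwise-≡⇒≡ (ext λ j → agree π^ty≈y j refl)

  Moves-τ⁻^ : ∀ t {n x j} → π^ n x ≡ x → Moves t x j → Moves t x (τ⁻^ (t * n) j)
  Moves-τ⁻^ t {n} {x} {j} π^nx≡x moves stays = moves (begin
    lookup (π^ t x) j           ≡⟨ cong (λ z → lookup (π^ t z) j) π^Kx≡x ⟨
    lookup (π^ t (π^ K x)) j    ≡⟨ cong (λ z → lookup z j) (π^-comm t K x) ⟩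
    lookup (π^ K (π^ t x)) j    ≡⟨ lookup-π^-cong K stays ⟩
    lookup (π^ K x) j           ≡⟨ cong (λ z → lookup z j) π^Kx≡x ⟩
    lookup x j                  ∎)
    where
    open ≡-Reasoning
    K : ℕ
    K = t * n
    π^Kx≡x : π^ K x ≡ x
    π^Kx≡x = π^-*-fixed π^nx≡x t

  moves-off⇒∈ : ∀ {t S x j} → π^ t x ≈[ ∁ S ] x → Moves t x j → S j ≡ true
  moves-off⇒∈ {S = S} {j = j} stays moves with S j in S[j]
  ... | true = refl
  ... | false = contradiction (agree stays j (cong not S[j])) moves

  shifted-periods-isSubtractive : ∀ {t S} → Invariant t S → ∀ y →
    IsSubtractiveSubmonoid (λ k → π^ (t * k) y ≈[ S ] y)
  shifted-periods-isSubtractive {t} {S} inv =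
    stabiliser-isSubtractive (≈[]-isEquivalence S) (λ k → π^ (t * k))
      (λ y → cong (λ k → π^ k y) (*-zeroʳ t)) (scale-+ π^ π^-+ t)
      (λ k → π^-preserves-≈[] (t * k) (Invariant-* {t} inv k))

  -- π^t preserves agreement on S, so the k with π^(tk) y ≈[ S ] y are the multiples of some nontrivial
  -- power of p, and every period of x is such a k.
  prime∣period-of-agreeing : ∀ t {S p e x y n j} → Invariant t S → Prime p →
    π^ (t * p ^ e) y ≡ y → S j ≡ true → Moves t y j → x ≈[ S ] y → π^ n x ≡ x → p ∣ n
  prime∣period-of-agreeing t {S} {p} {e} {x} {y} {n} {j} inv pp π^tp^ey≡y j∈S moves x≈y π^nx≡x =
    prime∣members (λ k → ≈[]-dec S (π^ (t * k) y) y) {e = e} pp (reflexive π^tp^ey≡y) ¬1∈ n∈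
    where
    open IsSubtractiveSubmonoid (shifted-periods-isSubtractive {t} inv y)
    open IsEquivalence (≈[]-isEquivalence S) renaming (sym to ≈-sym; trans to ≈-trans)
    ¬1∈ : ¬ π^ (t * 1) y ≈[ S ] y
    ¬1∈ t1∈ = moves (trans (cong (λ k → lookup (π^ k y) j) (sym (*-identityʳ t))) (agree t1∈ j j∈S))
    n∈ : π^ (t * n) y ≈[ S ] y
    n∈ = ≈-trans (≈-sym (π^-preserves-≈[] (t * n) (Invariant-* {t} inv n) x≈y))
                 (≈-trans (reflexive (π^-*-fixed {n = n} π^nx≡x t)) x≈y)

  HasCycleDivisibleBy : ℕ → Set
  HasCycleDivisibleBy d = ∃[ x ] ∃[ n ] (CycleSize π x n × d ∣ n)

  HasCycleDivisibleBy-comm : ∀ {p q} → HasCycleDivisibleBy (p * q) → HasCycleDivisibleBy (q * p)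
  HasCycleDivisibleBy-comm {p} {q} (x , n , cs , pq∣n) = x , n , cs , subst (_∣ n) (*-comm p q) pq∣n

  glued-cycle : ∀ t {S p q e f y z j k} → Invariant t S → Prime p → Prime q → p ≢ q →
    π^ (t * p ^ e) y ≡ y → S j ≡ true → Moves t y j →
    π^ (t * q ^ f) z ≡ z → ∁ S k ≡ true → Moves t z k → HasCycleDivisibleBy (p * q)
  glued-cycle t {S} {e = e} {f} {y} {z} inv pp pq p≢q fix-y j∈S y-moves fix-z k∉S z-moves
    with cycleSize (glue S y z)
  ... | n , cs@(_ , π^nx≡x , _) = glue S y z , n , cs , coprime-∣⇒*∣ (distinct-primes⇒coprime pp pq p≢q)
    (prime∣period-of-agreeing t {e = e} inv pp fix-y j∈S y-moves (glue-≈ˡ S y z) π^nx≡x)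
    (prime∣period-of-agreeing t {e = f} (Invariant-∁ {t} {S} inv) pq fix-z k∉S z-moves (glue-≈ʳ S y z) π^nx≡x)

  coordinate-periods-isSubtractive : ∀ t j → IsSubtractiveSubmonoid (λ k → τ⁻^ (t * k) j ≡ j)
  coordinate-periods-isSubtractive t =
    stabiliser-isSubtractive isEquivalence (λ k → τ⁻^ (t * k)) (λ j → cong (λ k → τ⁻^ k j) (*-zeroʳ t))
      (scale-+ τ⁻^ τ⁻^-+ t) (λ k → cong (τ⁻^ (t * k)))

  orbitLength : ∀ t j → ∃ (IsLeastPositive (λ k → τ⁻^ (t * k) j ≡ j))
  orbitLength t j with recurrent (↣-id (Fin r)) (λ k → τ⁻^ (t * k)) (scale-+ τ⁻^ τ⁻^-+ t) (λ k → τ⁻^-injective (t * k)) j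
  ... | k , 0<k , fixed = leastPositive (λ k → τ⁻^ (t * k) j ≟ᶠ j) 0<k fixed

  -- κ = τ^(-t) is the coordinate permutation underlying π^t; in InOrbit j, e is the distance from j to j₀.
  module Orbit (t : ℕ) {j₀ : Fin r} {c : ℕ} (c-least : IsLeastPositive (λ k → τ⁻^ (t * k) j₀ ≡ j₀) c) where

    κ^ : ℕ → Fin r → Fin r
    κ^ k = τ⁻^ (t * k)

    κ^-+ : ∀ a b j → κ^ (a + b) j ≡ κ^ a (κ^ b j)
    κ^-+ = scale-+ τ⁻^ τ⁻^-+ t

    κ^-comm : ∀ a b j → κ^ a (κ^ b j) ≡ κ^ b (κ^ a j)
    κ^-comm a b j = trans (sym (κ^-+ a b j)) (trans (cong (λ k → κ^ k j) (+-comm a b)) (κ^-+ b a j))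

    κ^-zero : ∀ j → κ^ 0 j ≡ j
    κ^-zero j = cong (λ k → τ⁻^ k j) (*-zeroʳ t)

    κ^-suc : ∀ e j → κ^ (suc e) j ≡ κ^ e (τ⁻^ t j)
    κ^-suc e j = trans (cong (λ k → τ⁻^ k j) (trans (*-suc t e) (+-comm t (t * e)))) (τ⁻^-+ (t * e) t j)

    0<c : 0 < c
    0<c = proj₁ c-least

    κ^c-j₀ : κ^ c j₀ ≡ j₀
    κ^c-j₀ = proj₁ (proj₂ c-least)

    c-pred : c ≡ suc (c ∸ 1)
    c-pred = trans (sym (m∸n+n≡m 0<c)) (+-comm (c ∸ 1) 1)

    c∸1<c : c ∸ 1 < c
    c∸1<c = subst (c ∸ 1 <_) (sym c-pred) (n<1+n (c ∸ 1))

    κ^c∸1-τ⁻^j₀ : κ^ (c ∸ 1) (τ⁻^ t j₀) ≡ j₀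
    κ^c∸1-τ⁻^j₀ = trans (sym (κ^-suc (c ∸ 1) j₀)) (trans (cong (λ k → κ^ k j₀) (sym c-pred)) κ^c-j₀)

    InOrbit : Fin r → Set
    InOrbit j = ∃ λ e → e < c × κ^ e j ≡ j₀

    InOrbit? : Decidable InOrbit
    InOrbit? j with any? (λ (e : Fin c) → κ^ (toℕ e) j ≟ᶠ j₀)
    ... | yes (e , reaches) = yes (toℕ e , toℕ<n e , reaches)
    ... | no ¬reaches = no λ (e , e<c , reaches) →
      ¬reaches (fromℕ< e<c , subst (λ k → κ^ k j ≡ j₀) (sym (toℕ-fromℕ< e<c)) reaches)

    orbit : CoordSet r
    orbit j = does (InOrbit? j)

    j₀∈ : InOrbit j₀
    j₀∈ = 0 , 0<c , κ^-zero j₀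

    κ^-j₀-minimal : ∀ k → 0 < k → k < c → κ^ k j₀ ≢ j₀
    κ^-j₀-minimal = proj₂ (proj₂ c-least)

    κ^-return : ∀ {j a b} → a < b → κ^ a j ≡ j₀ → κ^ b j ≡ j₀ → κ^ (b ∸ a) j₀ ≡ j₀
    κ^-return {j} {a} {b} a<b κ^aj κ^bj = begin
      κ^ (b ∸ a) j₀           ≡⟨ cong (κ^ (b ∸ a)) κ^aj ⟨
      κ^ (b ∸ a) (κ^ a j)     ≡⟨ κ^-+ (b ∸ a) a j ⟨
      κ^ (b ∸ a + a) j        ≡⟨ cong (λ k → κ^ k j) (m∸n+n≡m (<⇒≤ a<b)) ⟩
      κ^ b j                  ≡⟨ κ^bj ⟩
      j₀                      ∎
      where open ≡-Reasoning

    distance-unique : ∀ {j d e} → d < c → e < c → κ^ d j ≡ j₀ → κ^ e j ≡ j₀ → d ≡ e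
    distance-unique {j} {d} {e} d<c e<c κ^dj κ^ej with <-cmp d e
    ... | tri≈ _ d≡e _ = d≡e
    ... | tri< d<e _ _ = contradiction (κ^-return d<e κ^dj κ^ej)
                           (κ^-j₀-minimal (e ∸ d) (m<n⇒0<n∸m d<e) (≤-<-trans (m∸n≤m e d) e<c))
    ... | tri> _ _ e<d = contradiction (κ^-return e<d κ^ej κ^dj)
                           (κ^-j₀-minimal (d ∸ e) (m<n⇒0<n∸m e<d) (≤-<-trans (m∸n≤m d e) d<c))

    κ^-injective : ∀ k → Injective _≡_ _≡_ (κ^ k)
    κ^-injective k = τ⁻^-injective (t * k)

    κ^c-fixes : ∀ {j} → InOrbit j → κ^ c j ≡ j
    κ^c-fixes {j} (e , _ , κ^ej) = κ^-injective e (begin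
      κ^ e (κ^ c j) ≡⟨ κ^-comm e c j ⟩
      κ^ c (κ^ e j) ≡⟨ cong (κ^ c) κ^ej ⟩
      κ^ c j₀       ≡⟨ κ^c-j₀ ⟩
      j₀            ≡⟨ κ^ej ⟨
      κ^ e j        ∎)
      where open ≡-Reasoning

    τ⁻^-InOrbit : ∀ {j} → InOrbit j → InOrbit (τ⁻^ t j)
    τ⁻^-InOrbit {j} (zero , _ , κ^0j) =
      subst (λ i → InOrbit (τ⁻^ t i)) (trans (sym κ^0j) (κ^-zero j)) (c ∸ 1 , c∸1<c , κ^c∸1-τ⁻^j₀)
    τ⁻^-InOrbit {j} (suc e , 1+e<c , κ^1+ej) = e , <-trans (n<1+n e) 1+e<c , trans (sym (κ^-suc e j)) κ^1+ej

    τ⁻^-InOrbit⁻ : ∀ {j} → InOrbit (τ⁻^ t j) → InOrbit j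
    τ⁻^-InOrbit⁻ {j} (e , e<c , κ^eτj) with suc e <? c
    ... | yes 1+e<c = suc e , 1+e<c , trans (κ^-suc e j) κ^eτj
    ... | no 1+e≮c = subst InOrbit (sym j≡j₀) j₀∈
      where
      j≡j₀ : j ≡ j₀
      j≡j₀ = κ^-injective c (begin
        κ^ c j        ≡⟨ cong (λ k → κ^ k j) (≤-antisym e<c (≮⇒≥ 1+e≮c)) ⟨
        κ^ (suc e) j  ≡⟨ κ^-suc e j ⟩
        κ^ e (τ⁻^ t j) ≡⟨ κ^eτj ⟩
        j₀            ≡⟨ κ^c-j₀ ⟨
        κ^ c j₀       ∎)
        where open ≡-Reasoning

    orbit-Invariant : Invariant t orbit
    orbit-Invariant j = does-⇔ (mk⇔ τ⁻^-InOrbit⁻ τ⁻^-InOrbit) (InOrbit? (τ⁻^ t j)) (InOrbit? j)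

    InOrbit⇒∈ : ∀ {j} → InOrbit j → orbit j ≡ true
    InOrbit⇒∈ {j} = dec-true (InOrbit? j)

    ∈⇒InOrbit : ∀ {j} → orbit j ≡ true → InOrbit j
    ∈⇒InOrbit {j} = does⇒ (InOrbit? j)

    κ^-InOrbit : ∀ n {j} → InOrbit j → InOrbit (κ^ n j)
    κ^-InOrbit n {j} j∈ = ∈⇒InOrbit (trans (Invariant-* {t} orbit-Invariant n j) (InOrbit⇒∈ j∈))

    member-orbitLength : ∀ {j} → InOrbit j → IsLeastPositive (λ k → κ^ k j ≡ j) c
    member-orbitLength {j} j∈@(e , _ , κ^ej) = 0<c , κ^c-fixes j∈ , λ k 0<k k<c κ^kj → κ^-j₀-minimal k 0<k k<c (begin
      κ^ k j₀       ≡⟨ cong (κ^ k) κ^ej ⟨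
      κ^ k (κ^ e j) ≡⟨ κ^-comm k e j ⟩
      κ^ e (κ^ k j) ≡⟨ cong (κ^ e) κ^kj ⟩
      κ^ e j        ≡⟨ κ^ej ⟩
      j₀            ∎)
      where open ≡-Reasoning

    orbitLength∣ : ∀ {j n} → InOrbit j → κ^ n j ≡ j → c ∣ n
    orbitLength∣ {j} j∈ = IsSubtractiveSubmonoid.leastPositive∣ (coordinate-periods-isSubtractive t j) (member-orbitLength j∈)

    π^-t-step : ∀ e y → π^ t (π^ (t * e) y) ≡ π^ (t * suc e) y
    π^-t-step e y = trans (sym (π^-+ t (t * e) y)) (cong (λ k → π^ k y) (sym (*-suc t e)))

    -- Replacing each coordinate of the orbit by its value after as many steps of π^t as its distance to j₀
    -- concentrates the motion of π^t along the orbit in the single coordinate j₀.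
    unwound-value : Point m r → ∀ j → Dec (InOrbit j) → Fin m
    unwound-value z j (yes (e , _)) = lookup (π^ (t * e) z) j
    unwound-value z j (no _) = lookup z j

    unwind : Point m r → Point m r
    unwind z = tabulate λ j → unwound-value z j (InOrbit? j)

    lookup-unwind : ∀ z {j e} → e < c → κ^ e j ≡ j₀ → lookup (unwind z) j ≡ lookup (π^ (t * e) z) j
    lookup-unwind z {j} {e} e<c κ^ej = trans (lookup∘tabulate _ j) (value (InOrbit? j))
      where
      value : (j∈? : Dec (InOrbit j)) → unwound-value z j j∈? ≡ lookup (π^ (t * e) z) j
      value (yes (d , d<c , κ^dj)) = cong (λ k → lookup (π^ (t * k) z) j) (distance-unique d<c e<c κ^dj κ^ej)
      value (no j∉) = contradiction (e , e<c , κ^ej) j∉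

    unwind-j₀ : ∀ z → lookup (unwind z) j₀ ≡ lookup z j₀
    unwind-j₀ z = trans (lookup-unwind z 0<c (κ^-zero j₀)) (cong (λ k → lookup (π^ k z) j₀) (*-zeroʳ t))

    unwind-stays : ∀ z {j} → InOrbit j → j ≢ j₀ → lookup (π^ t (unwind z)) j ≡ lookup (unwind z) j
    unwind-stays z {j} (zero , _ , κ^0j) j≢j₀ = contradiction (trans (sym (κ^-zero j)) κ^0j) j≢j₀
    unwind-stays z {j} (suc e , 1+e<c , κ^1+ej) _ = begin
      lookup (π^ t (unwind z)) j          ≡⟨ lookup-π^-cong t (lookup-unwind z (<-trans (n<1+n e) 1+e<c) κ^eτj) ⟩
      lookup (π^ t (π^ (t * e) z)) j      ≡⟨ cong (λ x → lookup x j) (π^-t-step e z) ⟩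
      lookup (π^ (t * suc e) z) j         ≡⟨ lookup-unwind z 1+e<c κ^1+ej ⟨
      lookup (unwind z) j                 ∎
      where
      open ≡-Reasoning
      κ^eτj : κ^ e (τ⁻^ t j) ≡ j₀
      κ^eτj = trans (sym (κ^-suc e j)) κ^1+ej

    unwind-step-j₀ : ∀ z → lookup (π^ t (unwind z)) j₀ ≡ lookup (π^ (t * c) z) j₀
    unwind-step-j₀ z = begin
      lookup (π^ t (unwind z)) j₀             ≡⟨ lookup-π^-cong t (lookup-unwind z c∸1<c κ^c∸1-τ⁻^j₀) ⟩
      lookup (π^ t (π^ (t * (c ∸ 1)) z)) j₀   ≡⟨ cong (λ x → lookup x j₀) (π^-t-step (c ∸ 1) z) ⟩
      lookup (π^ (t * suc (c ∸ 1)) z) j₀      ≡⟨ cong (λ k → lookup (π^ (t * k) z) j₀) c-pred ⟨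
      lookup (π^ (t * c) z) j₀                ∎
      where open ≡-Reasoning

    unwind-period : ∀ {p e z n} → Prime p → π^ (t * p ^ e) z ≡ z → Moves (t * c) z j₀ →
                    π^ n (unwind z) ≡ unwind z → (c ∣ n) × (p ∣ n)
    unwind-period {p} {e} {z} {n} pp fix-z z-moves π^nu≡u = c∣n , p∣n
      where
      u : Point m r
      u = unwind z

      u-moves : Moves t u j₀
      u-moves stays = z-moves (trans (sym (unwind-step-j₀ z)) (trans stays (unwind-j₀ z)))

      c∣n : c ∣ n
      c∣n with κ^ n j₀ ≟ᶠ j₀
      ... | yes κ^nj₀≡j₀ = orbitLength∣ j₀∈ κ^nj₀≡j₀
      ... | no κ^nj₀≢j₀ = contradiction (unwind-stays z (κ^-InOrbit n j₀∈) κ^nj₀≢j₀)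
                            (Moves-τ⁻^ t π^nu≡u u-moves)

      p∣n : p ∣ n
      p∣n = prime∣period-of-agreeing (t * c) {e = e} (⁅⁆-Invariant (t * c) κ^c-j₀) pp
              (π^-*-fixed-under t (p ^ e) fix-z c) (i∈⁅i⁆ j₀) z-moves
              (agreeOn λ j j∈ → subst (λ i → lookup u i ≡ lookup z i) (sym (∈⁅⁆⇒≡ j∈)) (unwind-j₀ z)) π^nu≡u

    κ^1 : ∀ j → κ^ 1 j ≡ τ⁻^ t j
    κ^1 j = cong (λ k → τ⁻^ k j) (*-identityʳ t)

    j₁ : Fin r
    j₁ = κ^ (c ∸ 1) j₀

    τ⁻^-j₁ : τ⁻^ t j₁ ≡ j₀
    τ⁻^-j₁ = trans (τ⁻^-comm t (t * (c ∸ 1)) j₀) κ^c∸1-τ⁻^j₀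

    module _ (2<c : 2 < c) where

      1<c : 1 < c
      1<c = <-trans (s≤s (s≤s z≤n)) 2<c

      τ⁻^-j₀≢j₀ : τ⁻^ t j₀ ≢ j₀
      τ⁻^-j₀≢j₀ eq = κ^-j₀-minimal 1 (s≤s z≤n) 1<c (trans (κ^1 j₀) eq)

      j₁∈ : InOrbit j₁
      j₁∈ = 1 , 1<c , trans (κ^1 j₁) τ⁻^-j₁

      j₁≢j₀ : j₁ ≢ j₀
      j₁≢j₀ j₁≡j₀ = τ⁻^-j₀≢j₀ (trans (cong (τ⁻^ t) (sym j₁≡j₀)) τ⁻^-j₁)

      kink : Point m r → Fin m → Point m r
      kink z y = unwind z [ j₀ ]≔ y

      lookup-kink : ∀ z y {j} → j ≢ j₀ → lookup (kink z y) j ≡ lookup (unwind z) j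
      lookup-kink z y {j} j≢j₀ = lookup∘updateAt′ j j₀ j≢j₀ (unwind z)

      kink-moves-j₁ : ∀ z {y} → y ≢ lookup (unwind z) j₀ → Moves t (kink z y) j₁
      kink-moves-j₁ z {y} y≢ stays = y≢ (σ^-injective t j₁ (begin
        σ^ t j₁ y                                ≡⟨ cong (σ^ t j₁) (lookup∘updateAt j₀ (unwind z)) ⟨
        σ^ t j₁ (lookup (kink z y) j₀)           ≡⟨ cong (λ i → σ^ t j₁ (lookup (kink z y) i)) τ⁻^-j₁ ⟨
        σ^ t j₁ (lookup (kink z y) (τ⁻^ t j₁))   ≡⟨ lookup-π^ t (kink z y) j₁ ⟨
        lookup (π^ t (kink z y)) j₁              ≡⟨ stays ⟩
        lookup (kink z y) j₁                     ≡⟨ lookup-kink z y j₁≢j₀ ⟩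
        lookup (unwind z) j₁                     ≡⟨ unwind-stays z j₁∈ j₁≢j₀ ⟨
        lookup (π^ t (unwind z)) j₁              ≡⟨ lookup-π^ t (unwind z) j₁ ⟩
        σ^ t j₁ (lookup (unwind z) (τ⁻^ t j₁))   ≡⟨ cong (λ i → σ^ t j₁ (lookup (unwind z) i)) τ⁻^-j₁ ⟩
        σ^ t j₁ (lookup (unwind z) j₀)           ∎))
        where open ≡-Reasoning

      kink-stays : ∀ z y {j} → InOrbit j → j ≢ j₀ → j ≢ j₁ → lookup (π^ t (kink z y)) j ≡ lookup (kink z y) j
      kink-stays z y {j} j∈ j≢j₀ j≢j₁ = begin
        lookup (π^ t (kink z y)) j   ≡⟨ lookup-π^-cong t (lookup-kink z y τ⁻^tj≢j₀) ⟩
        lookup (π^ t (unwind z)) j   ≡⟨ unwind-stays z j∈ j≢j₀ ⟩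
        lookup (unwind z) j          ≡⟨ lookup-kink z y j≢j₀ ⟨
        lookup (kink z y) j          ∎
        where
        open ≡-Reasoning
        τ⁻^tj≢j₀ : τ⁻^ t j ≢ j₀
        τ⁻^tj≢j₀ eq = j≢j₁ (τ⁻^-injective t (trans eq (sym τ⁻^-j₁)))

      τ⁻^-j₀≢j₁ : τ⁻^ t j₀ ≢ j₁
      τ⁻^-j₀≢j₁ eq = κ^-j₀-minimal 2 (s≤s z≤n) 2<c (begin
        κ^ 2 j₀                ≡⟨ κ^-+ 1 1 j₀ ⟩
        κ^ 1 (κ^ 1 j₀)         ≡⟨ trans (κ^1 (κ^ 1 j₀)) (cong (τ⁻^ t) (κ^1 j₀)) ⟩
        τ⁻^ t (τ⁻^ t j₀)       ≡⟨ cong (τ⁻^ t) eq ⟩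
        τ⁻^ t j₁               ≡⟨ τ⁻^-j₁ ⟩
        j₀                     ∎)
        where open ≡-Reasoning

      -- On the orbit, π^t moves the kinked point only at j₁ and possibly j₀, and κ^n maps moving
      -- coordinates to moving ones; κ^n j₁ = j₀ would force κ^n j₀ = κ j₀, which is neither j₀ nor j₁ as c > 2.
      kink-period : ∀ z {y n} → y ≢ lookup (unwind z) j₀ → π^ n (kink z y) ≡ kink z y → c ∣ n
      kink-period z {y} {n} y≢ π^nx≡x with κ^ n j₁ ≟ᶠ j₁ | κ^ n j₁ ≟ᶠ j₀
      ... | yes κ^nj₁≡j₁ | _ = orbitLength∣ j₁∈ κ^nj₁≡j₁
      ... | no κ^nj₁≢j₁ | no κ^nj₁≢j₀ =
        contradiction (kink-stays z y (κ^-InOrbit n j₁∈) κ^nj₁≢j₀ κ^nj₁≢j₁) (Moves-τ⁻^ t π^nx≡x (kink-moves-j₁ z y≢))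
      ... | no _ | yes κ^nj₁≡j₀ = contradiction (kink-stays z y (τ⁻^-InOrbit j₀∈) τ⁻^-j₀≢j₀ τ⁻^-j₀≢j₁) moves-τ⁻^j₀
        where
        κ^nj₀≡τ⁻^j₀ : κ^ n j₀ ≡ τ⁻^ t j₀
        κ^nj₀≡τ⁻^j₀ = begin
          κ^ n j₀               ≡⟨ cong (κ^ n) τ⁻^-j₁ ⟨
          κ^ n (τ⁻^ t j₁)       ≡⟨ τ⁻^-comm (t * n) t j₁ ⟩
          τ⁻^ t (κ^ n j₁)       ≡⟨ cong (τ⁻^ t) κ^nj₁≡j₀ ⟩
          τ⁻^ t j₀              ∎
          where open ≡-Reasoning
        moves-j₀ : Moves t (kink z y) j₀
        moves-j₀ = subst (Moves t (kink z y)) κ^nj₁≡j₀ (Moves-τ⁻^ t π^nx≡x (kink-moves-j₁ z y≢))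
        moves-τ⁻^j₀ : Moves t (kink z y) (τ⁻^ t j₀)
        moves-τ⁻^j₀ = subst (Moves t (kink z y)) κ^nj₀≡τ⁻^j₀ (Moves-τ⁻^ t π^nx≡x moves-j₀)

  π^-≈[]-* : ∀ {t S y} → Invariant t S → π^ t y ≈[ S ] y → ∀ k → π^ (t * k) y ≈[ S ] y
  π^-≈[]-* {t} {S} {y} inv π^ty≈y k = subst (λ i → π^ (t * i) y ≈[ S ] y) (*-identityʳ k)
    (IsSubtractiveSubmonoid.*-closed (shifted-periods-isSubtractive {t} inv y)
      (subst (λ i → π^ i y ≈[ S ] y) (sym (*-identityʳ t)) π^ty≈y) k)

  kinked-cycle : ∀ {t p q j₀ c} (c-least : IsLeastPositive (λ k → τ⁻^ (t * k) j₀ ≡ j₀) c) →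
    Prime p → Prime q → p ≢ q → p ∣ c → q ∣ c → ∀ {v w : Fin m} → v ≢ w → HasCycleDivisibleBy (p * q)
  kinked-cycle {t} {p} {q} {j₀} {c} c-least pp pq p≢q p∣c q∣c {v} v≢w =
    x , n , cs , ∣-trans pq∣c (O.kink-period 2<c z y≢ (proj₁ (proj₂ cs)))
    where
    module O = Orbit t c-least
    z : Point m r
    z = replicate r v
    pq∣c : p * q ∣ c
    pq∣c = coprime-∣⇒*∣ (distinct-primes⇒coprime pp pq p≢q) p∣c q∣c
    2<c : 2 < c
    2<c = <-≤-trans (≤-trans (n≤1+n 3) (*-mono-≤ (prime>1 pp) (prime>1 pq))) (∣⇒≤ ⦃ >-nonZero O.0<c ⦄ pq∣c)
    y : Fin m
    y = proj₁ (other-than v≢w (lookup (O.unwind z) j₀))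
    y≢ : y ≢ lookup (O.unwind z) j₀
    y≢ = proj₂ (other-than v≢w (lookup (O.unwind z) j₀))
    x : Point m r
    x = O.kink 2<c z y
    n : ℕ
    n = proj₁ (cycleSize x)
    cs : CycleSize π x n
    cs = proj₂ (cycleSize x)

  unwound-cycle : ∀ {t p q e n y j₀ c} (c-least : IsLeastPositive (λ k → τ⁻^ (t * k) j₀ ≡ j₀) c) →
    Prime p → Prime q → p ≢ q → p ∣ c → ¬ q ∣ c →
    CycleSize π y n → q ∣ n → ¬ q ∣ t → π^ (t * q ^ e) y ≡ y →
    π^ t y ≈[ ∁ (Orbit.orbit t c-least) ] y → HasCycleDivisibleBy (p * q)
  unwound-cycle {t} {p} {q} {e} {y = y} {c = c} c-least pp pq p≢q p∣c q∤c cs q∣n q∤t fix-y stays =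
    u , n′ , cs′ , coprime-∣⇒*∣ (distinct-primes⇒coprime pp pq p≢q) (∣-trans p∣c (proj₁ divides-n′)) (proj₂ divides-n′)
    where
    module O = Orbit t c-least
    moving : ∃ (Moves (t * c) y)
    moving = moves-somewhere cs q∣n (prime∤* pq q∤t q∤c)
    j∈ : O.InOrbit (proj₁ moving)
    j∈ = O.∈⇒InOrbit (moves-off⇒∈ {t * c} (π^-≈[]-* {t} (Invariant-∁ {t} O.orbit-Invariant) stays c) (proj₂ moving))
    module O′ = Orbit t (O.member-orbitLength j∈)
    u : Point m r
    u = O′.unwind y
    n′ : ℕ
    n′ = proj₁ (cycleSize u)
    cs′ : CycleSize π u n′
    cs′ = proj₂ (cycleSize u)
    divides-n′ : (c ∣ n′) × (q ∣ n′)
    divides-n′ = O′.unwind-period {e = e} pq fix-y (proj₂ moving) (proj₁ (proj₂ cs′))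

  orbit-cycle : ∀ {t p q e n y j₀ c} (c-least : IsLeastPositive (λ k → τ⁻^ (t * k) j₀ ≡ j₀) c) →
    Prime p → Prime q → p ≢ q → p ∣ c →
    CycleSize π y n → q ∣ n → ¬ q ∣ t → π^ (t * q ^ e) y ≡ y →
    π^ t y ≈[ ∁ (Orbit.orbit t c-least) ] y → ∀ {v w : Fin m} → v ≢ w → HasCycleDivisibleBy (p * q)
  orbit-cycle {t} {q = q} {e} {c = c} c-least pp pq p≢q p∣c cs q∣n q∤t fix-y stays v≢w with q ∣? c
  ... | yes q∣c = kinked-cycle {t} c-least pp pq p≢q p∣c q∣c v≢w
  ... | no q∤c = unwound-cycle {t} {e = e} c-least pp pq p≢q p∣c q∤c cs q∣n q∤t fix-y stays

module Reduction {m : ℕ} {G : Subgroup m} {r : ℕ} (π : WreathElt G r) {q s : ℕ} (pq : Prime q) (ps : Prime s) (q≢s : q ≢ s)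
         {a b : Point m r} {na nb : ℕ} (csa : CycleSize π a na) (q∣na : q ∣ na) (csb : CycleSize π b nb) (s∣nb : s ∣ nb)
         (ea eb : ℕ) where
  open WreathElt π using (τ)

  Localised : Set
  Localised = ∃[ i ] ∃[ t ] (Coprime ∣ t ∣ (q * s)
    × permPow τ t i ≡ i
    × (∀ (j : Fin r) → j ≢ i → lookup (pow π t a) j ≡ lookup a j × lookup (pow π t b) j ≡ lookup b j))

  Outcome : Set
  Outcome = HasCycleDivisibleBy π (q * s) ⊎ Localised

  record Admissible (t : ℕ) : Set where
    constructor admissible
    field
      q∤t : ¬ q ∣ t
      s∤t : ¬ s ∣ t
      a-fixed : π^ π (t * q ^ ea) a ≡ a
      b-fixed : π^ π (t * s ^ eb) b ≡ b

  Admissible-* : ∀ {t c} → Admissible t → ¬ q ∣ c → ¬ s ∣ c → Admissible (t * c)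
  Admissible-* {t} {c} adm q∤c s∤c = record
    { q∤t = prime∤* pq q∤t q∤c
    ; s∤t = prime∤* ps s∤t s∤c
    ; a-fixed = π^-*-fixed-under π t (q ^ ea) a-fixed c
    ; b-fixed = π^-*-fixed-under π t (s ^ eb) b-fixed c
    }
    where open Admissible adm

  permPow-τ⁻^ : ∀ n j → permPow τ (+ n) (τ⁻^ π n j) ≡ j
  permPow-τ⁻^ zero j = refl
  permPow-τ⁻^ (suc n) j = trans (cong (τ ⟨$⟩ʳ_) (permPow-τ⁻^ n (τ ⟨$⟩ˡ j))) (inverseʳ τ)

  localised : ∀ {t i} → Admissible t → τ⁻^ π t i ≡ i →
    π^ π t a ≈[ ∁ ⁅ i ⁆ ] a → π^ π t b ≈[ ∁ ⁅ i ⁆ ] b → Localised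
  localised {t} {i} (admissible q∤t s∤t _ _) fix a-stays b-stays =
    i , + t , coprime-* (prime∤⇒coprime pq q∤t) (prime∤⇒coprime ps s∤t) ,
    trans (cong (permPow τ (+ t)) (sym fix)) (permPow-τ⁻^ t i) ,
    λ j j≢i → agree a-stays j (≢⇒∈∁⁅⁆ j≢i) , agree b-stays j (≢⇒∈∁⁅⁆ j≢i)

  glue-or-stationary : ∀ {t S ja jb} → Admissible t → Invariant π t S → S ja ≡ true → Moves π t a ja → Moves π t b jb →
    HasCycleDivisibleBy π (q * s) ⊎ (π^ π t a ≈[ ∁ S ] a × π^ π t b ≈[ ∁ S ] b)
  glue-or-stationary {t} {S} (admissible _ _ a-fixed b-fixed) inv ja∈S a-moves b-moves with agree-or-differ (∁ S) (π^ π t b) b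
  ... | inj₂ (k , k∉S , b-moves′) =
    inj₁ (glued-cycle π t {e = ea} {eb} inv pq ps q≢s a-fixed ja∈S a-moves b-fixed k∉S b-moves′)
  ... | inj₁ b-stays with agree-or-differ (∁ S) (π^ π t a) a
  ...   | inj₁ a-stays = inj₂ (a-stays , b-stays)
  ...   | inj₂ (k , k∉S , a-moves′) =
    inj₁ (HasCycleDivisibleBy-comm π {s} {q} (glued-cycle π t {e = eb} {ea} inv ps pq (q≢s ∘ sym)
      b-fixed (moves-off⇒∈ π {t} b-stays b-moves) b-moves a-fixed k∉S a-moves′))

  singleton-outcome : ∀ {t i} → Admissible t → τ⁻^ π t i ≡ i → Moves π t a i → Outcome
  singleton-outcome {t} {i} adm@(admissible _ s∤t _ _) fix a-moves with moves-somewhere π csb s∣nb s∤t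
  ... | jb , b-moves = map₂ (λ (a-stays , b-stays) → localised adm fix a-stays b-stays)
    (glue-or-stationary adm (⁅⁆-Invariant π t fix) (i∈⁅i⁆ i) a-moves b-moves)

  orbit-outcome : ∀ {t ja c} → Admissible t → Moves π t a ja →
    (c-least : IsLeastPositive (λ k → τ⁻^ π (t * k) ja ≡ ja) c) →
    π^ π t a ≈[ ∁ (Orbit.orbit π t c-least) ] a → π^ π t b ≈[ ∁ (Orbit.orbit π t c-least) ] b → Outcome
  orbit-outcome {t} {c = c} adm@(admissible q∤t s∤t a-fixed b-fixed) a-moves c-least a-stays b-stays
    with q ∣? c | s ∣? c
  ... | yes q∣c | _ = inj₁ (orbit-cycle π {t} {e = eb} c-least pq ps q≢s q∣c csb s∣nb s∤t b-fixed b-stays a-moves)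
  ... | no _ | yes s∣c = inj₁ (HasCycleDivisibleBy-comm π {s} {q}
    (orbit-cycle π {t} {e = ea} c-least ps pq (q≢s ∘ sym) s∣c csa q∣na q∤t a-fixed a-stays a-moves))
  ... | no q∤c | no s∤c = singleton-outcome (Admissible-* adm q∤c s∤c) (O.κ^c-fixes ja′∈) (proj₂ moving)
    where
    module O = Orbit π t c-least
    moving : ∃ (Moves π (t * c) a)
    moving = moves-somewhere π csa q∣na (prime∤* pq q∤t q∤c)
    ja′∈ : O.InOrbit (proj₁ moving)
    ja′∈ = O.∈⇒InOrbit (moves-off⇒∈ π {t * c} (π^-≈[]-* π {t} (Invariant-∁ π {t} O.orbit-Invariant) a-stays c) (proj₂ moving))

  admissible-outcome : ∀ {t} → Admissible t → Outcome
  admissible-outcome {t} adm@(admissible q∤t s∤t _ _)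
    with moves-somewhere π csa q∣na q∤t | moves-somewhere π csb s∣nb s∤t
  ... | ja , a-moves | jb , b-moves with orbitLength π t ja
  ...   | c , c-least = let module O = Orbit π t c-least in
    [ inj₁ , (λ (a-stays , b-stays) → orbit-outcome adm a-moves c-least a-stays b-stays) ]′
      (glue-or-stationary adm O.orbit-Invariant (O.InOrbit⇒∈ O.j₀∈) a-moves b-moves)

  admissible-product : ∀ {ua ub} → na ≡ q ^ ea * ua → ¬ q ∣ ua → nb ≡ s ^ eb * ub → ¬ s ∣ ub →
                       ¬ s ∣ na → ¬ q ∣ nb → Admissible (ua * ub)
  admissible-product {ua} {ub} na≡ q∤ua nb≡ s∤ub s∤na q∤nb = record
    { q∤t = prime∤* pq q∤ua (λ q∣ub → q∤nb (∣-trans q∣ub (divides (s ^ eb) nb≡)))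
    ; s∤t = prime∤* ps (λ s∣ua → s∤na (∣-trans s∣ua (divides (q ^ ea) na≡))) s∤ub
    ; a-fixed = trans (cong (λ k → π^ π k a) a-exponent) (π^-*-fixed π (proj₁ (proj₂ csa)) ub)
    ; b-fixed = trans (cong (λ k → π^ π k b) b-exponent) (π^-*-fixed π (proj₁ (proj₂ csb)) ua)
    }
    where
    a-exponent : ua * ub * q ^ ea ≡ ub * na
    a-exponent = begin
      ua * ub * q ^ ea     ≡⟨ cong (_* q ^ ea) (*-comm ua ub) ⟩
      ub * ua * q ^ ea     ≡⟨ *-assoc ub ua (q ^ ea) ⟩
      ub * (ua * q ^ ea)   ≡⟨ cong (ub *_) (trans (*-comm ua (q ^ ea)) (sym na≡)) ⟩
      ub * na              ∎
      where open ≡-Reasoning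
    b-exponent : ua * ub * s ^ eb ≡ ua * nb
    b-exponent = trans (*-assoc ua ub (s ^ eb)) (cong (ua *_) (trans (*-comm ub (s ^ eb)) (sym nb≡)))

proposition4p8 : (m : ℕ) (G : Subgroup m) (r : ℕ) → 1 ≤ r →
    (π : WreathElt G r) (a b : Point m r) (q s : ℕ) → Prime q → Prime s → q ≢ s →
    (∃[ na ] (CycleSize π a na × q ∣ na)) →
    (∃[ nb ] (CycleSize π b nb × s ∣ nb)) →
    (∃[ x ] ∃[ n ] (CycleSize π x n × (q * s) ∣ n))
    ⊎ (∃[ i ] ∃[ t ] (Coprime ∣ t ∣ (q * s)
         × permPow (WreathElt.τ π) t i ≡ i
         × (∀ (j : Fin r) → j ≢ i →
              lookup (pow π t a) j ≡ lookup a j × lookup (pow π t b) j ≡ lookup b j)))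
proposition4p8 m G r _ π a b q s pq ps q≢s (na , csa , q∣na) (nb , csb , s∣nb) with s ∣? na | q ∣? nb
... | yes s∣na | _ = inj₁ (a , na , csa , coprime-∣⇒*∣ (distinct-primes⇒coprime pq ps q≢s) q∣na s∣na)
... | no _ | yes q∣nb = inj₁ (b , nb , csb , coprime-∣⇒*∣ (distinct-primes⇒coprime pq ps q≢s) q∣nb s∣nb)
... | no s∤na | no q∤nb
  with split-prime-part pq na (proj₁ csa) | split-prime-part ps nb (proj₁ csb)
...   | ea , ua , na≡ , q∤ua | eb , ub , nb≡ , s∤ub =
  R.admissible-outcome (R.admissible-product na≡ q∤ua nb≡ s∤ub s∤na q∤nb)
  where module R = Reduction π pq ps q≢s csa q∣na csb s∣nb ea eb
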